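{- For any sentence $\varphi$ of $\mathbb T$, the sequent $\top\vdash\varphi$ is provable in $\mathbb T$ if and only if $\varphi$ is true in the standard model $\mathbb N$.
   Context: Coherent logic: formulas built from atomic formulas (including equalities) using only $\top,\bot,\wedge,\vee,\exists$; sequents $\varphi\vdash_{\bar x}\psi$ derived with the standard coherent deduction system. PrimRec is the set of primitive recursive function descriptions generated from $\mathsf z$ (constant $0$), $\mathsf s$ (successor), projections $\pi^n_k$, composition $\mathrm{Cn}[\mathsf h,\mathsf g_1,\dots,\mathsf g_n]$ and primitive recursion $\mathrm{Pr}[\mathsf g,\mathsf h]$. The coherent arithmetic $\mathbb T$ has a constant $\mathsf 0$, a function symbol for each element of PrimRec, and a binary predicate $<$, with axioms: $\mathsf zx=\mathsf 0$; $\pi^n_k(x_1,\dots,x_n)=x_k$; $\mathsf sx=\mathsf 0\vdash\bot$; $\mathsf sx=\mathsf sy\vdash x=y$; the defining equations of each composition and primitive recursion symbol; $x<y\dashv\vdash\exists z(x+\mathsf sz=y)$ with $+$ the PrimRec addition. Formulas may also use bounded universal quantifiers $\forall z<t\,\varphi$ ($t$ not containing $z$) with the double rule $\psi\vdash\forall z<t\,\varphi$ iff $\psi\wedge z<t\vdash\varphi$ ($z$ not free in $\psi$), and $\mathbb T$ has the induction rules (IndR): from $\psi(\bar x)\vdash\varphi(\bar x,\mathsf 0)$ and $\psi(\bar x)\wedge\varphi(\bar x,y)\vdash\varphi(\bar x,\mathsf sy)$ infer $\psi(\bar x)\vdash_{\bar x,y}\varphi(\bar x,y)$; (IndL): from $\psi(\bar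 x,\mathsf 0)\vdash\varphi(\bar x)$ and $\psi(\bar x,\mathsf sy)\vdash\varphi(\bar x)\vee\psi(\bar x,y)$ infer $\psi(\bar x,y)\vdash_{\bar x,y}\varphi(\bar x)$. The standard model interprets everything in $\mathbb N$ in the usual way. -}

module Defs where

open import Data.Nat using (ℕ; zero; suc; _<_)
open import Data.Fin using (Fin; zero; suc)
open import Data.Vec using (Vec; []; _∷_; _∷ʳ_; lookup; tabulate; init; last)
open import Data.Product using (Σ; _×_)
open import Data.Sum using (_⊎_)
open import Data.Unit using (⊤)
open import Data.Empty using (⊥)
open import Relation.Binary.PropositionalEquality using (_≡_)

-- PrimRec: primitive recursive function descriptions, indexed by arity.
--   z      : the constant-zero function (unary),   z x = 0
--   s      : successor (unary)
--   π n k  : projection π^n_{k+1}(x_1..x_n) = x_{k+1}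
--   Cn h gs: Cn[h,g_1..g_n](x̄) = h(g_1 x̄, .., g_n x̄)
--   Pr g h : Pr[g,h](x̄,0) = g(x̄),  Pr[g,h](x̄,s y) = h(x̄,y,Pr[g,h](x̄,y))

data PR : ℕ → Set where
  z  : PR 1
  s  : PR 1
  π  : (n : ℕ) → Fin n → PR n
  Cn : {n m : ℕ} → PR n → Vec (PR m) n → PR m
  Pr : {n : ℕ} → PR n → PR (suc (suc n)) → PR (suc n)

mutual
  ⟦_⟧ : {k : ℕ} → PR k → Vec ℕ k → ℕ
  ⟦ z ⟧ _ = 0
  ⟦ s ⟧ (x ∷ []) = suc x
  ⟦ π n k ⟧ xs = lookup xs k
  ⟦ Cn h gs ⟧ xs = ⟦ h ⟧ (⟦ gs ⟧* xs)
  ⟦ Pr g h ⟧ xs = prec g h (init xs) (last xs)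

  ⟦_⟧* : {n m : ℕ} → Vec (PR m) n → Vec ℕ m → Vec ℕ n
  ⟦ [] ⟧* xs = []
  ⟦ g ∷ gs ⟧* xs = ⟦ g ⟧ xs ∷ ⟦ gs ⟧* xs

  prec : {n : ℕ} → PR n → PR (suc (suc n)) → Vec ℕ n → ℕ → ℕ
  prec g h xs zero = ⟦ g ⟧ xs
  prec g h xs (suc y) = ⟦ h ⟧ ((xs ∷ʳ y) ∷ʳ prec g h xs y)

add : PR 2
add = Pr (π 1 zero) (Cn s (π 3 (suc (suc zero)) ∷ []))

-- Syntax of T: well-scoped terms and formulas (de Bruijn; a binder binds
-- variable zero, outer variables are shifted by suc).

data Tm (n : ℕ) : Set where
  var : Fin n → Tm n
  𝟘   : Tm n
  app : {k : ℕ} → PR k → Vec (Tm n) k → Tm n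

infix 6 _≐_ _≺_
infixr 5 _∧'_
infixr 4 _∨'_

data Fm (n : ℕ) : Set where
  _≐_  : Tm n → Tm n → Fm n
  _≺_  : Tm n → Tm n → Fm n
  ⊤'   : Fm n
  ⊥'   : Fm n
  _∧'_ : Fm n → Fm n → Fm n
  _∨'_ : Fm n → Fm n → Fm n
  ∃'   : Fm (suc n) → Fm n
  ∀<'  : Tm n → Fm (suc n) → Fm n

Sentence : Set
Sentence = Fm 0

Ren : ℕ → ℕ → Set
Ren n m = Fin n → Fin m

liftR : {n m : ℕ} → Ren n m → Ren (suc n) (suc m)
liftR ρ zero = zero
liftR ρ (suc i) = suc (ρ i)

mutual
  renT : {n m : ℕ} → Ren n m → Tm n → Tm m
  renT ρ (var i) = var (ρ i)
  renT ρ 𝟘 = 𝟘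
  renT ρ (app f ts) = app f (renT* ρ ts)

  renT* : {n m k : ℕ} → Ren n m → Vec (Tm n) k → Vec (Tm m) k
  renT* ρ [] = []
  renT* ρ (t ∷ ts) = renT ρ t ∷ renT* ρ ts

Sub : ℕ → ℕ → Set
Sub n m = Fin n → Tm m

liftS : {n m : ℕ} → Sub n m → Sub (suc n) (suc m)
liftS σ zero = var zero
liftS σ (suc i) = renT suc (σ i)

mutual
  subT : {n m : ℕ} → Sub n m → Tm n → Tm m
  subT σ (var i) = σ i
  subT σ 𝟘 = 𝟘
  subT σ (app f ts) = app f (subT* σ ts)

  subT* : {n m k : ℕ} → Sub n m → Vec (Tm n) k → Vec (Tm m) k
  subT* σ [] = []
  subT* σ (t ∷ ts) = subT σ t ∷ subT* σ ts

_[_] : {n m : ℕ} → Fm n → Sub n m → Fm m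
(t ≐ u) [ σ ] = subT σ t ≐ subT σ u
(t ≺ u) [ σ ] = subT σ t ≺ subT σ u
⊤' [ σ ] = ⊤'
⊥' [ σ ] = ⊥'
(φ ∧' ψ) [ σ ] = (φ [ σ ]) ∧' (ψ [ σ ])
(φ ∨' ψ) [ σ ] = (φ [ σ ]) ∨' (ψ [ σ ])
∃' φ [ σ ] = ∃' (φ [ liftS σ ])
∀<' t φ [ σ ] = ∀<' (subT σ t) (φ [ liftS σ ])

wk : {n : ℕ} → Fm n → Fm (suc n)
wk φ = φ [ (λ i → var (suc i)) ]

wkT : {n : ℕ} → Tm n → Tm (suc n)
wkT = renT suc

_⟨_⟩ : {n : ℕ} → Fm (suc n) → Tm n → Fm n
φ ⟨ t ⟩ = φ [ (λ { zero → t ; (suc i) → var i }) ]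

S : {n : ℕ} → Tm n → Tm n
S t = app s (t ∷ [])

succ0 : {n : ℕ} → Sub (suc n) (suc n)
succ0 zero = S (var zero)
succ0 (suc i) = var (suc i)

-- Coherent deduction system (Johnstone's sequent calculus for coherent
-- logic) plus the bounded universal quantifier rules and the axioms and
-- induction rules of T.   Der n φ ψ  means  φ ⊢_{x̄} ψ  with |x̄| = n.

appAll : {n m k : ℕ} → Vec (PR n) m → Vec (Tm k) n → Vec (Tm k) m
appAll [] xs = []
appAll (g ∷ gs) xs = app g xs ∷ appAll gs xs

data Der : (n : ℕ) → Fm n → Fm n → Set where
  iden  : {n : ℕ} {φ : Fm n} → Der n φ φ
  cut   : {n : ℕ} {φ ψ χ : Fm n} → Der n φ ψ → Der n ψ χ → Der n φ χ
  subst : {n m : ℕ} {φ ψ : Fm n} (σ : Sub n m) → Der n φ ψ → Der m (φ [ σ ]) (ψ [ σ ])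
  eq-refl  : Der 1 ⊤' (var zero ≐ var zero)
  eq-repl  : {n : ℕ} (t u : Tm n) (φ : Fm (suc n)) → Der n ((t ≐ u) ∧' (φ ⟨ t ⟩)) (φ ⟨ u ⟩)
  ⊤-intro : {n : ℕ} {φ : Fm n} → Der n φ ⊤'
  ∧-elimˡ : {n : ℕ} {φ ψ : Fm n} → Der n (φ ∧' ψ) φ
  ∧-elimʳ : {n : ℕ} {φ ψ : Fm n} → Der n (φ ∧' ψ) ψ
  ∧-intro : {n : ℕ} {φ ψ χ : Fm n} → Der n φ ψ → Der n φ χ → Der n φ (ψ ∧' χ)
  ⊥-elim  : {n : ℕ} {φ : Fm n} → Der n ⊥' φ
  ∨-introˡ : {n : ℕ} {φ ψ : Fm n} → Der n φ (φ ∨' ψ)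
  ∨-introʳ : {n : ℕ} {φ ψ : Fm n} → Der n ψ (φ ∨' ψ)
  ∨-elim  : {n : ℕ} {φ ψ χ : Fm n} → Der n φ χ → Der n ψ χ → Der n (φ ∨' ψ) χ
  ∃-left  : {n : ℕ} {φ : Fm (suc n)} {ψ : Fm n} → Der (suc n) φ (wk ψ) → Der n (∃' φ) ψ
  ∃-left⁻ : {n : ℕ} {φ : Fm (suc n)} {ψ : Fm n} → Der n (∃' φ) ψ → Der (suc n) φ (wk ψ)
  distr : {n : ℕ} {φ ψ χ : Fm n} → Der n (φ ∧' (ψ ∨' χ)) ((φ ∧' ψ) ∨' (φ ∧' χ))
  frob  : {n : ℕ} {φ : Fm n} {ψ : Fm (suc n)} → Der n (φ ∧' ∃' ψ) (∃' (wk φ ∧' ψ))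
  ∀<-right  : {n : ℕ} {ψ : Fm n} {t : Tm n} {φ : Fm (suc n)} →
              Der (suc n) (wk ψ ∧' (var zero ≺ wkT t)) φ → Der n ψ (∀<' t φ)
  ∀<-right⁻ : {n : ℕ} {ψ : Fm n} {t : Tm n} {φ : Fm (suc n)} →
              Der n ψ (∀<' t φ) → Der (suc n) (wk ψ ∧' (var zero ≺ wkT t)) φ
  ax-z    : Der 1 ⊤' (app z (var zero ∷ []) ≐ 𝟘)
  ax-π    : (n : ℕ) (k : Fin n) → Der n ⊤' (app (π n k) (tabulate var) ≐ var k)
  ax-s0   : Der 1 (S (var zero) ≐ 𝟘) ⊥'
  ax-sinj : Der 2 (S (var zero) ≐ S (var (suc zero))) (var zero ≐ var (suc zero))
  ax-Cn   : {n m : ℕ} (h : PR n) (gs : Vec (PR m) n) →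
            Der m ⊤' (app (Cn h gs) (tabulate var) ≐ app h (appAll gs (tabulate var)))
  ax-Pr0  : {n : ℕ} (g : PR n) (h : PR (suc (suc n))) →
            Der n ⊤' (app (Pr g h) (tabulate var ∷ʳ 𝟘) ≐ app g (tabulate var))
  ax-PrS  : {n : ℕ} (g : PR n) (h : PR (suc (suc n))) →
            Der (suc n) ⊤'
              (app (Pr g h) (tabulate (λ i → var (suc i)) ∷ʳ S (var zero))
               ≐ app h ((tabulate (λ i → var (suc i)) ∷ʳ var zero)
                         ∷ʳ app (Pr g h) (tabulate (λ i → var (suc i)) ∷ʳ var zero)))
  -- x < y ⊣⊢ ∃z (x + s z = y);  here x = var 0, y = var 1 (under ∃: var 1, var 2)
  ax-<⇒   : Der 2 (var zero ≺ var (suc zero))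
              (∃' (app add (var (suc zero) ∷ S (var zero) ∷ []) ≐ var (suc (suc zero))))
  ax-<⇐   : Der 2 (∃' (app add (var (suc zero) ∷ S (var zero) ∷ []) ≐ var (suc (suc zero))))
              (var zero ≺ var (suc zero))
  -- induction rules; the induction variable y is variable zero
  IndR : {n : ℕ} {ψ : Fm n} {φ : Fm (suc n)} →
         Der n ψ (φ ⟨ 𝟘 ⟩) → Der (suc n) (wk ψ ∧' φ) (φ [ succ0 ]) →
         Der (suc n) (wk ψ) φ
  IndL : {n : ℕ} {ψ : Fm (suc n)} {φ : Fm n} →
         Der n (ψ ⟨ 𝟘 ⟩) φ → Der (suc n) (ψ [ succ0 ]) (wk φ ∨' ψ) →
         Der (suc n) ψ (wk φ)

_,,_ : {n : ℕ} → (Fin n → ℕ) → ℕ → (Fin (suc n) → ℕ)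
(ρ ,, a) zero = a
(ρ ,, a) (suc i) = ρ i

mutual
  evalT : {n : ℕ} → (Fin n → ℕ) → Tm n → ℕ
  evalT ρ (var i) = ρ i
  evalT ρ 𝟘 = 0
  evalT ρ (app f ts) = ⟦ f ⟧ (evalT* ρ ts)

  evalT* : {n k : ℕ} → (Fin n → ℕ) → Vec (Tm n) k → Vec ℕ k
  evalT* ρ [] = []
  evalT* ρ (t ∷ ts) = evalT ρ t ∷ evalT* ρ ts

Sat : {n : ℕ} → (Fin n → ℕ) → Fm n → Set
Sat ρ (t ≐ u) = evalT ρ t ≡ evalT ρ u
Sat ρ (t ≺ u) = evalT ρ t < evalT ρ u
Sat ρ ⊤' = ⊤
Sat ρ ⊥' = ⊥
Sat ρ (φ ∧' ψ) = Sat ρ φ × Sat ρ ψ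
Sat ρ (φ ∨' ψ) = Sat ρ φ ⊎ Sat ρ ψ
Sat ρ (∃' φ) = Σ ℕ (λ a → Sat (ρ ,, a) φ)
Sat ρ (∀<' t φ) = (a : ℕ) → a < evalT ρ t → Sat (ρ ,, a) φ

TrueInℕ : Sentence → Set
TrueInℕ φ = Sat (λ ()) φ

Provable : Sentence → Set
Provable φ = Der 0 ⊤' φ

-- Soundness is induction on derivations; the induction rules are sound because
-- every natural number is reached from 0 by finitely many successors.
-- For completeness, every closed term is provably equal to the numeral of its value:
-- by induction on primitive recursive descriptions, unfolding the defining equations
-- (for Pr[g,h] by an inner induction on the numeral in the last argument).  Hence
-- true atomic sentences are provable.  Since coherent formulas are positive, truth of
-- a compound sentence is witnessed by provable instances at numerals: one witness for
-- ∃, and for ∀ z < t finitely many instances z = 0, …, n-1, glued together by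
-- x < S y ⊢ x < y ∨ x = y.

module Submission where

open import Defs
open import Data.Nat using (ℕ; zero; suc; _<_; _+_; _∸_; z<s)
open import Data.Nat.Properties using (+-identityʳ; +-suc; m+[n∸m]≡n; m<m+n; suc-injective; n<1+n; m<n⇒m<1+n)
open import Data.Fin using (Fin; zero; suc)
open import Data.Vec using (Vec; []; _∷_; _∷ʳ_; lookup; tabulate; initLast)
open import Data.Vec.Properties using (lookup∘tabulate; tabulate∘lookup; init-∷ʳ; last-∷ʳ)
open import Data.Vec.Relation.Unary.All using (All; []; _∷_)
open import Data.Vec.Relation.Unary.All.Properties using (lookup⁺)
open import Data.Product using (_×_; _,_)
open import Data.Product.Function.NonDependent.Propositional using (_×-⇔_)
open import Data.Sum using (inj₁; inj₂)
open import Data.Sum.Function.Propositional using (_⊎-⇔_)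
open import Data.Unit using (tt)
open import Function using (id; _⇔_; mk⇔; Equivalence)
open import Relation.Binary.PropositionalEquality as ≡ using (_≡_; refl; cong; cong₂; sym; trans; module ≡-Reasoning)

open Equivalence using (to; from)

private
  variable
    n m l k : ℕ
    χ : Fm n
    t t′ u u′ w : Tm n

num : ℕ → Tm n
num zero = 𝟘
num (suc a) = S (num a)

sub₀ : Tm n → Sub (suc n) n
sub₀ t zero = t
sub₀ t (suc i) = var i

mutual
  subT-cong : {σ τ : Sub n m} → (∀ i → σ i ≡ τ i) → (t : Tm n) → subT σ t ≡ subT τ t
  subT-cong e (var i) = e i
  subT-cong e 𝟘 = refl
  subT-cong e (app f ts) = cong (app f) (subT*-cong e ts)

  subT*-cong : {σ τ : Sub n m} → (∀ i → σ i ≡ τ i) → (ts : Vec (Tm n) k) → subT* σ ts ≡ subT* τ ts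
  subT*-cong e [] = refl
  subT*-cong e (t ∷ ts) = cong₂ _∷_ (subT-cong e t) (subT*-cong e ts)

mutual
  subT-subT : (σ : Sub n m) (τ : Sub m l) (t : Tm n) → subT τ (subT σ t) ≡ subT (λ i → subT τ (σ i)) t
  subT-subT σ τ (var i) = refl
  subT-subT σ τ 𝟘 = refl
  subT-subT σ τ (app f ts) = cong (app f) (subT*-subT σ τ ts)

  subT*-subT : (σ : Sub n m) (τ : Sub m l) (ts : Vec (Tm n) k) →
               subT* τ (subT* σ ts) ≡ subT* (λ i → subT τ (σ i)) ts
  subT*-subT σ τ [] = refl
  subT*-subT σ τ (t ∷ ts) = cong₂ _∷_ (subT-subT σ τ t) (subT*-subT σ τ ts)

mutual
  renT≡subT : (ρ : Ren n m) (t : Tm n) → renT ρ t ≡ subT (λ i → var (ρ i)) t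
  renT≡subT ρ (var i) = refl
  renT≡subT ρ 𝟘 = refl
  renT≡subT ρ (app f ts) = cong (app f) (renT*≡subT* ρ ts)

  renT*≡subT* : (ρ : Ren n m) (ts : Vec (Tm n) k) → renT* ρ ts ≡ subT* (λ i → var (ρ i)) ts
  renT*≡subT* ρ [] = refl
  renT*≡subT* ρ (t ∷ ts) = cong₂ _∷_ (renT≡subT ρ t) (renT*≡subT* ρ ts)

mutual
  subT-id : {σ : Sub n n} → (∀ i → σ i ≡ var i) → (t : Tm n) → subT σ t ≡ t
  subT-id e (var i) = e i
  subT-id e 𝟘 = refl
  subT-id e (app f ts) = cong (app f) (subT*-id e ts)

  subT*-id : {σ : Sub n n} → (∀ i → σ i ≡ var i) → (ts : Vec (Tm n) k) → subT* σ ts ≡ ts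
  subT*-id e [] = refl
  subT*-id e (t ∷ ts) = cong₂ _∷_ (subT-id e t) (subT*-id e ts)

subT-renT : (ρ : Ren n m) (σ : Sub m l) (t : Tm n) → subT σ (renT ρ t) ≡ subT (λ i → σ (ρ i)) t
subT-renT ρ σ t = trans (cong (subT σ) (renT≡subT ρ t)) (subT-subT _ σ t)

renT-subT : (σ : Sub n m) (ρ : Ren m l) (t : Tm n) → renT ρ (subT σ t) ≡ subT (λ i → renT ρ (σ i)) t
renT-subT σ ρ t = begin
  renT ρ (subT σ t)                         ≡⟨ renT≡subT ρ (subT σ t) ⟩
  subT (λ i → var (ρ i)) (subT σ t)         ≡⟨ subT-subT σ _ t ⟩
  subT (λ i → subT _ (σ i)) t               ≡⟨ subT-cong (λ i → sym (renT≡subT ρ (σ i))) t ⟩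
  subT (λ i → renT ρ (σ i)) t               ∎
  where open ≡-Reasoning

sub₀-wkT : (t w : Tm n) → subT (sub₀ t) (wkT w) ≡ w
sub₀-wkT t w = trans (subT-renT suc (sub₀ t) w) (subT-id (λ _ → refl) w)

subT-num : (σ : Sub n m) (a : ℕ) → subT σ (num a) ≡ num a
subT-num σ zero = refl
subT-num σ (suc a) = cong S (subT-num σ a)

liftS-cong : {σ τ : Sub n m} → (∀ i → σ i ≡ τ i) → ∀ i → liftS σ i ≡ liftS τ i
liftS-cong e zero = refl
liftS-cong e (suc i) = cong wkT (e i)

liftS-id : {σ : Sub n n} → (∀ i → σ i ≡ var i) → ∀ i → liftS σ i ≡ var i
liftS-id e zero = refl
liftS-id e (suc i) = cong wkT (e i)

liftS-subT : (σ : Sub n m) (τ : Sub m l) → ∀ i → subT (liftS τ) (liftS σ i) ≡ liftS (λ j → subT τ (σ j)) i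
liftS-subT σ τ zero = refl
liftS-subT σ τ (suc i) = trans (subT-renT suc (liftS τ) (σ i)) (sym (renT-subT τ suc (σ i)))

[]-cong : {σ τ : Sub n m} → (∀ i → σ i ≡ τ i) → (φ : Fm n) → φ [ σ ] ≡ φ [ τ ]
[]-cong e (t ≐ u) = cong₂ _≐_ (subT-cong e t) (subT-cong e u)
[]-cong e (t ≺ u) = cong₂ _≺_ (subT-cong e t) (subT-cong e u)
[]-cong e ⊤' = refl
[]-cong e ⊥' = refl
[]-cong e (φ ∧' ψ) = cong₂ _∧'_ ([]-cong e φ) ([]-cong e ψ)
[]-cong e (φ ∨' ψ) = cong₂ _∨'_ ([]-cong e φ) ([]-cong e ψ)
[]-cong e (∃' φ) = cong ∃' ([]-cong (liftS-cong e) φ)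
[]-cong e (∀<' t φ) = cong₂ ∀<' (subT-cong e t) ([]-cong (liftS-cong e) φ)

[]-[] : (σ : Sub n m) (τ : Sub m l) (φ : Fm n) → (φ [ σ ]) [ τ ] ≡ φ [ (λ i → subT τ (σ i)) ]
[]-[] σ τ (t ≐ u) = cong₂ _≐_ (subT-subT σ τ t) (subT-subT σ τ u)
[]-[] σ τ (t ≺ u) = cong₂ _≺_ (subT-subT σ τ t) (subT-subT σ τ u)
[]-[] σ τ ⊤' = refl
[]-[] σ τ ⊥' = refl
[]-[] σ τ (φ ∧' ψ) = cong₂ _∧'_ ([]-[] σ τ φ) ([]-[] σ τ ψ)
[]-[] σ τ (φ ∨' ψ) = cong₂ _∨'_ ([]-[] σ τ φ) ([]-[] σ τ ψ)
[]-[] σ τ (∃' φ) = cong ∃' (trans ([]-[] (liftS σ) (liftS τ) φ) ([]-cong (liftS-subT σ τ) φ))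
[]-[] σ τ (∀<' t φ) =
  cong₂ ∀<' (subT-subT σ τ t) (trans ([]-[] (liftS σ) (liftS τ) φ) ([]-cong (liftS-subT σ τ) φ))

[]-id : {σ : Sub n n} → (∀ i → σ i ≡ var i) → (φ : Fm n) → φ [ σ ] ≡ φ
[]-id e (t ≐ u) = cong₂ _≐_ (subT-id e t) (subT-id e u)
[]-id e (t ≺ u) = cong₂ _≺_ (subT-id e t) (subT-id e u)
[]-id e ⊤' = refl
[]-id e ⊥' = refl
[]-id e (φ ∧' ψ) = cong₂ _∧'_ ([]-id e φ) ([]-id e ψ)
[]-id e (φ ∨' ψ) = cong₂ _∨'_ ([]-id e φ) ([]-id e ψ)
[]-id e (∃' φ) = cong ∃' ([]-id (liftS-id e) φ)
[]-id e (∀<' t φ) = cong₂ ∀<' (subT-id e t) ([]-id (liftS-id e) φ)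

[]-[]-≗ : {σ : Sub n m} {τ : Sub m l} {υ : Sub n l} → (∀ i → subT τ (σ i) ≡ υ i) →
          (φ : Fm n) → (φ [ σ ]) [ τ ] ≡ φ [ υ ]
[]-[]-≗ e φ = trans ([]-[] _ _ φ) ([]-cong e φ)

-- _⟨_⟩ substitutes through an anonymous pattern lambda, so this holds only propositionally.
⟨⟩≡[sub₀] : (φ : Fm (suc n)) (t : Tm n) → φ ⟨ t ⟩ ≡ φ [ sub₀ t ]
⟨⟩≡[sub₀] φ t = []-cong (λ { zero → refl ; (suc i) → refl }) φ

[]-⟨⟩-≗ : {σ : Sub (suc n) (suc m)} {υ : Sub (suc n) m} (t : Tm m) → (∀ i → subT (sub₀ t) (σ i) ≡ υ i) →
          (φ : Fm (suc n)) → (φ [ σ ]) ⟨ t ⟩ ≡ φ [ υ ]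
[]-⟨⟩-≗ t e φ = trans (⟨⟩≡[sub₀] _ t) ([]-[]-≗ e φ)

wk-sub₀ : (ψ : Fm n) (t : Tm n) → wk ψ [ sub₀ t ] ≡ ψ
wk-sub₀ ψ t = trans ([]-[] _ (sub₀ t) ψ) ([]-id (λ _ → refl) ψ)

subT*-tabulate : (σ : Sub n m) (f : Fin k → Tm n) → subT* σ (tabulate f) ≡ tabulate (λ i → subT σ (f i))
subT*-tabulate {k = zero} σ f = refl
subT*-tabulate {k = suc k} σ f = cong (subT σ (f zero) ∷_) (subT*-tabulate σ (λ i → f (suc i)))

subT*-∷ʳ : (σ : Sub n m) (ts : Vec (Tm n) k) (t : Tm n) → subT* σ (ts ∷ʳ t) ≡ subT* σ ts ∷ʳ subT σ t
subT*-∷ʳ σ [] t = refl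
subT*-∷ʳ σ (u ∷ ts) t = cong (subT σ u ∷_) (subT*-∷ʳ σ ts t)

subT*-appAll : (σ : Sub n m) (gs : Vec (PR k) l) (ts : Vec (Tm n) k) → subT* σ (appAll gs ts) ≡ appAll gs (subT* σ ts)
subT*-appAll σ [] ts = refl
subT*-appAll σ (g ∷ gs) ts = cong (app g (subT* σ ts) ∷_) (subT*-appAll σ gs ts)

subT*-lookup-tabulate : (ts : Vec (Tm m) n) → subT* (lookup ts) (tabulate var) ≡ ts
subT*-lookup-tabulate ts = trans (subT*-tabulate (lookup ts) var) (tabulate∘lookup ts)

Env : ℕ → Set
Env n = Fin n → ℕ

mutual
  evalT-subT : (ρ : Env m) (σ : Sub n m) (t : Tm n) → evalT ρ (subT σ t) ≡ evalT (λ i → evalT ρ (σ i)) t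
  evalT-subT ρ σ (var i) = refl
  evalT-subT ρ σ 𝟘 = refl
  evalT-subT ρ σ (app f ts) = cong ⟦ f ⟧ (evalT*-subT ρ σ ts)

  evalT*-subT : (ρ : Env m) (σ : Sub n m) (ts : Vec (Tm n) k) →
                evalT* ρ (subT* σ ts) ≡ evalT* (λ i → evalT ρ (σ i)) ts
  evalT*-subT ρ σ [] = refl
  evalT*-subT ρ σ (t ∷ ts) = cong₂ _∷_ (evalT-subT ρ σ t) (evalT*-subT ρ σ ts)

mutual
  evalT-cong : {ρ ρ′ : Env n} → (∀ i → ρ i ≡ ρ′ i) → (t : Tm n) → evalT ρ t ≡ evalT ρ′ t
  evalT-cong e (var i) = e i
  evalT-cong e 𝟘 = refl
  evalT-cong e (app f ts) = cong ⟦ f ⟧ (evalT*-cong e ts)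

  evalT*-cong : {ρ ρ′ : Env n} → (∀ i → ρ i ≡ ρ′ i) → (ts : Vec (Tm n) k) → evalT* ρ ts ≡ evalT* ρ′ ts
  evalT*-cong e [] = refl
  evalT*-cong e (t ∷ ts) = cong₂ _∷_ (evalT-cong e t) (evalT*-cong e ts)

evalT-subT-≗ : {ρ : Env m} {ρ′ : Env n} {σ : Sub n m} → (∀ i → evalT ρ (σ i) ≡ ρ′ i) →
               (t : Tm n) → evalT ρ (subT σ t) ≡ evalT ρ′ t
evalT-subT-≗ e t = trans (evalT-subT _ _ t) (evalT-cong e t)

evalT-wkT : (ρ : Env (suc n)) (t : Tm n) → evalT ρ (wkT t) ≡ evalT (λ i → ρ (suc i)) t
evalT-wkT ρ t = trans (cong (evalT ρ) (renT≡subT suc t)) (evalT-subT ρ _ t)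

evalT-num : (ρ : Env n) (a : ℕ) → evalT ρ (num a) ≡ a
evalT-num ρ zero = refl
evalT-num ρ (suc a) = cong suc (evalT-num ρ a)

evalT-liftS : {ρ : Env m} {ρ′ : Env n} {σ : Sub n m} → (∀ i → evalT ρ (σ i) ≡ ρ′ i) →
              (a : ℕ) → ∀ i → evalT (ρ ,, a) (liftS σ i) ≡ (ρ′ ,, a) i
evalT-liftS e a zero = refl
evalT-liftS {σ = σ} e a (suc i) = trans (evalT-wkT _ (σ i)) (e i)

≡-resp₂-⇔ : (R : ℕ → ℕ → Set) {a a′ b b′ : ℕ} → a ≡ a′ → b ≡ b′ → R a b ⇔ R a′ b′
≡-resp₂-⇔ R refl refl = mk⇔ id id

Sat-[] : (ρ : Env m) (ρ′ : Env n) (σ : Sub n m) → (∀ i → evalT ρ (σ i) ≡ ρ′ i) →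
         (φ : Fm n) → Sat ρ (φ [ σ ]) ⇔ Sat ρ′ φ
Sat-[] ρ ρ′ σ e (t ≐ u) = ≡-resp₂-⇔ _≡_ (evalT-subT-≗ e t) (evalT-subT-≗ e u)
Sat-[] ρ ρ′ σ e (t ≺ u) = ≡-resp₂-⇔ _<_ (evalT-subT-≗ e t) (evalT-subT-≗ e u)
Sat-[] ρ ρ′ σ e ⊤' = mk⇔ id id
Sat-[] ρ ρ′ σ e ⊥' = mk⇔ id id
Sat-[] ρ ρ′ σ e (φ ∧' ψ) = Sat-[] ρ ρ′ σ e φ ×-⇔ Sat-[] ρ ρ′ σ e ψ
Sat-[] ρ ρ′ σ e (φ ∨' ψ) = Sat-[] ρ ρ′ σ e φ ⊎-⇔ Sat-[] ρ ρ′ σ e ψ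
Sat-[] ρ ρ′ σ e (∃' φ) =
  mk⇔ (λ { (a , w) → a , to (body a) w }) (λ { (a , w) → a , from (body a) w })
  where
  body : (a : ℕ) → Sat (ρ ,, a) (φ [ liftS σ ]) ⇔ Sat (ρ′ ,, a) φ
  body a = Sat-[] (ρ ,, a) (ρ′ ,, a) (liftS σ) (evalT-liftS e a) φ
Sat-[] ρ ρ′ σ e (∀<' t φ) =
  mk⇔ (λ f a a<t → to (body a) (f a (≡.subst (a <_) (sym (evalT-subT-≗ e t)) a<t)))
      (λ f a a<t → from (body a) (f a (≡.subst (a <_) (evalT-subT-≗ e t) a<t)))
  where
  body : (a : ℕ) → Sat (ρ ,, a) (φ [ liftS σ ]) ⇔ Sat (ρ′ ,, a) φ
  body a = Sat-[] (ρ ,, a) (ρ′ ,, a) (liftS σ) (evalT-liftS e a) φ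

Sat-cong : {ρ ρ′ : Env n} → (∀ i → ρ i ≡ ρ′ i) → (φ : Fm n) → Sat ρ φ → Sat ρ′ φ
Sat-cong {ρ′ = ρ′} e φ w =
  ≡.subst (Sat ρ′) ([]-id (λ _ → refl) φ) (from (Sat-[] ρ′ _ var (λ i → sym (e i)) φ) w)

Sat-⟨⟩ : (ρ : Env n) (φ : Fm (suc n)) (t : Tm n) → Sat ρ (φ ⟨ t ⟩) ⇔ Sat (ρ ,, evalT ρ t) φ
Sat-⟨⟩ ρ φ t = Sat-[] ρ _ _ (λ { zero → refl ; (suc i) → refl }) φ

Sat-wk : (ρ : Env (suc n)) (ψ : Fm n) → Sat ρ (wk ψ) ⇔ Sat (λ i → ρ (suc i)) ψ
Sat-wk ρ ψ = Sat-[] ρ _ _ (λ _ → refl) ψ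

Sat-succ0 : (ρ : Env n) (y : ℕ) (φ : Fm (suc n)) → Sat (ρ ,, y) (φ [ succ0 ]) ⇔ Sat (ρ ,, suc y) φ
Sat-succ0 ρ y φ = Sat-[] (ρ ,, y) _ succ0 (λ { zero → refl ; (suc i) → refl }) φ

tail,,head : (ρ : Env (suc n)) → ∀ i → ((λ j → ρ (suc j)) ,, ρ zero) i ≡ ρ i
tail,,head ρ zero = refl
tail,,head ρ (suc i) = refl

lookup-evalT* : (ρ : Env n) (ts : Vec (Tm n) k) (i : Fin k) → lookup (evalT* ρ ts) i ≡ evalT ρ (lookup ts i)
lookup-evalT* ρ (t ∷ ts) zero = refl
lookup-evalT* ρ (t ∷ ts) (suc i) = lookup-evalT* ρ ts i

evalT*-∷ʳ : (ρ : Env n) (ts : Vec (Tm n) k) (t : Tm n) → evalT* ρ (ts ∷ʳ t) ≡ evalT* ρ ts ∷ʳ evalT ρ t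
evalT*-∷ʳ ρ [] t = refl
evalT*-∷ʳ ρ (u ∷ ts) t = cong (evalT ρ u ∷_) (evalT*-∷ʳ ρ ts t)

evalT*-appAll : (ρ : Env n) (gs : Vec (PR k) l) (ts : Vec (Tm n) k) →
                evalT* ρ (appAll gs ts) ≡ ⟦ gs ⟧* (evalT* ρ ts)
evalT*-appAll ρ [] ts = refl
evalT*-appAll ρ (g ∷ gs) ts = cong (⟦ g ⟧ (evalT* ρ ts) ∷_) (evalT*-appAll ρ gs ts)

⟦Pr⟧-∷ʳ : (g : PR k) (h : PR (suc (suc k))) (xs : Vec ℕ k) (y : ℕ) → ⟦ Pr g h ⟧ (xs ∷ʳ y) ≡ prec g h xs y
⟦Pr⟧-∷ʳ g h xs y = cong₂ (prec g h) (init-∷ʳ y xs) (last-∷ʳ y xs)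

⟦Pr⟧-evalT*-∷ʳ : (ρ : Env n) (g : PR k) (h : PR (suc (suc k))) (ts : Vec (Tm n) k) (t : Tm n) →
                 ⟦ Pr g h ⟧ (evalT* ρ (ts ∷ʳ t)) ≡ prec g h (evalT* ρ ts) (evalT ρ t)
⟦Pr⟧-evalT*-∷ʳ ρ g h ts t = trans (cong ⟦ Pr g h ⟧ (evalT*-∷ʳ ρ ts t)) (⟦Pr⟧-∷ʳ g h _ _)

⟦add⟧ : (a b : ℕ) → ⟦ add ⟧ (a ∷ b ∷ []) ≡ a + b
⟦add⟧ a zero = sym (+-identityʳ a)
⟦add⟧ a (suc b) = trans (cong suc (⟦add⟧ a b)) (sym (+-suc a b))

<⇒⟦add⟧-suc : {a b : ℕ} → a < b → ⟦ add ⟧ (a ∷ suc (b ∸ suc a) ∷ []) ≡ b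
<⇒⟦add⟧-suc {a} {b} a<b = trans (⟦add⟧ a _) (trans (+-suc a _) (m+[n∸m]≡n a<b))

⟦add⟧-suc⇒< : {a b c : ℕ} → ⟦ add ⟧ (a ∷ suc c ∷ []) ≡ b → a < b
⟦add⟧-suc⇒< {a} {b} {c} e = ≡.subst (a <_) (trans (sym (⟦add⟧ a (suc c))) e) (m<m+n a z<s)

soundness : {φ ψ : Fm n} → Der n φ ψ → (ρ : Env n) → Sat ρ φ → Sat ρ ψ
soundness iden ρ x = x
soundness (cut d e) ρ x = soundness e ρ (soundness d ρ x)
soundness (subst {φ = φ} {ψ = ψ} σ d) ρ x =
  from (Sat-[] ρ _ σ (λ _ → refl) ψ) (soundness d _ (to (Sat-[] ρ _ σ (λ _ → refl) φ) x))
soundness eq-refl ρ x = refl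
soundness (eq-repl t u φ) ρ (t≡u , x) =
  from (Sat-⟨⟩ ρ φ u) (Sat-cong (λ { zero → t≡u ; (suc i) → refl }) φ (to (Sat-⟨⟩ ρ φ t) x))
soundness ⊤-intro ρ x = tt
soundness ∧-elimˡ ρ (x , y) = x
soundness ∧-elimʳ ρ (x , y) = y
soundness (∧-intro d e) ρ x = soundness d ρ x , soundness e ρ x
soundness ⊥-elim ρ ()
soundness ∨-introˡ ρ x = inj₁ x
soundness ∨-introʳ ρ x = inj₂ x
soundness (∨-elim d e) ρ (inj₁ x) = soundness d ρ x
soundness (∨-elim d e) ρ (inj₂ x) = soundness e ρ x
soundness (∃-left {ψ = ψ} d) ρ (a , x) = to (Sat-wk (ρ ,, a) ψ) (soundness d (ρ ,, a) x)
soundness (∃-left⁻ {φ = φ} {ψ = ψ} d) ρ x =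
  from (Sat-wk ρ ψ) (soundness d _ (ρ zero , Sat-cong (λ i → sym (tail,,head ρ i)) φ x))
soundness distr ρ (x , inj₁ y) = inj₁ (x , y)
soundness distr ρ (x , inj₂ y) = inj₂ (x , y)
soundness (frob {φ = φ}) ρ (x , (a , y)) = a , (from (Sat-wk (ρ ,, a) φ) x , y)
soundness (∀<-right {ψ = ψ} {t = t} d) ρ x a a<t =
  soundness d (ρ ,, a) (from (Sat-wk (ρ ,, a) ψ) x , ≡.subst (a <_) (sym (evalT-wkT (ρ ,, a) t)) a<t)
soundness (∀<-right⁻ {ψ = ψ} {t = t} {φ = φ} d) ρ (x , ρ₀<t) =
  Sat-cong (tail,,head ρ) φ
    (soundness d _ (to (Sat-wk ρ ψ) x) (ρ zero) (≡.subst (ρ zero <_) (evalT-wkT ρ t) ρ₀<t))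
soundness ax-z ρ x = refl
soundness (ax-π n k) ρ x = trans (lookup-evalT* ρ (tabulate var) k) (cong (evalT ρ) (lookup∘tabulate var k))
soundness (ax-Cn h gs) ρ x = cong ⟦ h ⟧ (sym (evalT*-appAll ρ gs (tabulate var)))
soundness (ax-Pr0 g h) ρ x = ⟦Pr⟧-evalT*-∷ʳ ρ g h (tabulate var) 𝟘
soundness (ax-PrS g h) ρ x =
  trans (⟦Pr⟧-evalT*-∷ʳ ρ g h ts (S (var zero)))
        (cong ⟦ h ⟧ (sym (trans (evalT*-∷ʳ ρ (ts ∷ʳ var zero) _)
                                (cong₂ _∷ʳ_ (evalT*-∷ʳ ρ ts (var zero)) (⟦Pr⟧-evalT*-∷ʳ ρ g h ts (var zero))))))
  where ts = tabulate (λ i → var (suc i))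
soundness ax-s0 ρ ()
soundness ax-sinj ρ x = suc-injective x
soundness ax-<⇒ ρ a<b = ρ (suc zero) ∸ suc (ρ zero) , <⇒⟦add⟧-suc a<b
soundness ax-<⇐ ρ (c , e) = ⟦add⟧-suc⇒< {c = c} e
soundness (IndR {ψ = ψ} {φ = φ} base step) ρ x =
  Sat-cong (tail,,head ρ) φ (induct (ρ zero) (to (Sat-wk ρ ψ) x))
  where
  ρ₀ = λ i → ρ (suc i)
  induct : (y : ℕ) → Sat ρ₀ ψ → Sat (ρ₀ ,, y) φ
  induct zero w = to (Sat-⟨⟩ ρ₀ φ 𝟘) (soundness base ρ₀ w)
  induct (suc y) w =
    to (Sat-succ0 ρ₀ y φ) (soundness step (ρ₀ ,, y) (from (Sat-wk (ρ₀ ,, y) ψ) w , induct y w))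
soundness (IndL {ψ = ψ} {φ = φ} base step) ρ x =
  from (Sat-wk ρ φ) (descend (ρ zero) (Sat-cong (λ i → sym (tail,,head ρ i)) ψ x))
  where
  ρ₀ = λ i → ρ (suc i)
  descend : (y : ℕ) → Sat (ρ₀ ,, y) ψ → Sat ρ₀ φ
  descend zero w = soundness base ρ₀ (from (Sat-⟨⟩ ρ₀ ψ 𝟘) w)
  descend (suc y) w with soundness step (ρ₀ ,, y) (from (Sat-succ0 ρ₀ y ψ) w)
  ... | inj₁ v = to (Sat-wk (ρ₀ ,, y) φ) v
  ... | inj₂ v = descend y v

castʳ : {χ φ ψ : Fm n} → φ ≡ ψ → Der n χ φ → Der n χ ψ
castʳ refl d = d

castˡ : {χ φ ψ : Fm n} → φ ≡ ψ → Der n φ χ → Der n ψ χ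
castˡ refl d = d

instantiate : {φ ψ : Fm n} (ts : Vec (Tm m) n) → Der n φ ψ → Der m (φ [ lookup ts ]) (ψ [ lookup ts ])
instantiate ts = subst (lookup ts)

v₀ : Tm (suc n)
v₀ = var zero

v₁ : Tm (suc (suc n))
v₁ = var (suc zero)

v₂ : Tm (suc (suc (suc n)))
v₂ = var (suc (suc zero))

v₃ : Tm (suc (suc (suc (suc n))))
v₃ = var (suc (suc (suc zero)))

∃-intro : (φ : Fm (suc n)) (t : Tm n) → Der n (φ ⟨ t ⟩) (∃' φ)
∃-intro φ t = castˡ (sym (⟨⟩≡[sub₀] φ t)) (castʳ (wk-sub₀ (∃' φ) t) (subst (sub₀ t) (∃-left⁻ iden)))

≐-refl : (t : Tm n) → Der n χ (t ≐ t)
≐-refl t = cut ⊤-intro (instantiate (t ∷ []) eq-refl)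

≐-subst : (φ : Fm (suc n)) → Der n χ (t ≐ u) → Der n χ (φ ⟨ t ⟩) → Der n χ (φ ⟨ u ⟩)
≐-subst {t = t} {u = u} φ t≐u φt = cut (∧-intro t≐u φt) (eq-repl t u φ)

≐-sym : Der n χ (t ≐ u) → Der n χ (u ≐ t)
≐-sym {t = t} {u = u} t≐u =
  cut (∧-intro t≐u (≐-refl t)) (instantiate (t ∷ u ∷ []) (eq-repl v₀ v₁ (v₀ ≐ v₁)))

≐-trans : Der n χ (t ≐ u) → Der n χ (u ≐ w) → Der n χ (t ≐ w)
≐-trans {t = t} {u = u} {w = w} t≐u u≐w =
  cut (∧-intro u≐w t≐u) (instantiate (u ∷ w ∷ t ∷ []) (eq-repl v₀ v₁ (v₃ ≐ v₀)))

S-cong : Der n χ (t ≐ u) → Der n χ (S t ≐ S u)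
S-cong {t = t} {u = u} t≐u =
  cut (∧-intro t≐u (≐-refl (S t))) (instantiate (t ∷ u ∷ []) (eq-repl v₀ v₁ (S v₁ ≐ S v₀)))

S-injective : Der n χ (S t ≐ S u) → Der n χ (t ≐ u)
S-injective {t = t} {u = u} St≐Su = cut St≐Su (instantiate (t ∷ u ∷ []) ax-sinj)

S≢𝟘 : Der n χ (S t ≐ 𝟘) → Der n χ ⊥'
S≢𝟘 {t = t} St≐𝟘 = cut St≐𝟘 (instantiate (t ∷ []) ax-s0)

≺-respˡ : Der n χ (t ≐ t′) → Der n χ (t′ ≺ u) → Der n χ (t ≺ u)
≺-respˡ {t = t} {t′ = t′} {u = u} t≐t′ t′≺u =
  cut (∧-intro (≐-sym t≐t′) t′≺u) (instantiate (t′ ∷ t ∷ u ∷ []) (eq-repl v₀ v₁ (v₀ ≺ v₃)))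

≺-respʳ : Der n χ (u ≐ u′) → Der n χ (t ≺ u) → Der n χ (t ≺ u′)
≺-respʳ {u = u} {u′ = u′} {t = t} u≐u′ t≺u =
  cut (∧-intro u≐u′ t≺u) (instantiate (u ∷ u′ ∷ t ∷ []) (eq-repl v₀ v₁ (v₃ ≺ v₀)))

π-eq : (k : Fin n) (ts : Vec (Tm m) n) → Der m χ (app (π n k) ts ≐ lookup ts k)
π-eq k ts = cut ⊤-intro
  (castʳ (cong (λ us → app (π _ k) us ≐ lookup ts k) (subT*-lookup-tabulate ts)) (instantiate ts (ax-π _ k)))

Cn-eq : (h : PR n) (gs : Vec (PR m) n) (ts : Vec (Tm l) m) → Der l χ (app (Cn h gs) ts ≐ app h (appAll gs ts))
Cn-eq h gs ts = cut ⊤-intro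
  (castʳ (cong₂ (λ us vs → app (Cn h gs) us ≐ app h vs)
                (subT*-lookup-tabulate ts)
                (trans (subT*-appAll (lookup ts) gs (tabulate var)) (cong (appAll gs) (subT*-lookup-tabulate ts))))
         (instantiate ts (ax-Cn h gs)))

Pr-zero-eq : (g : PR n) (h : PR (suc (suc n))) (xs : Vec (Tm m) n) →
             Der m χ (app (Pr g h) (xs ∷ʳ 𝟘) ≐ app g xs)
Pr-zero-eq g h xs = cut ⊤-intro
  (castʳ (cong₂ (λ us vs → app (Pr g h) us ≐ app g vs)
                (trans (subT*-∷ʳ (lookup xs) (tabulate var) 𝟘) (cong (_∷ʳ 𝟘) (subT*-lookup-tabulate xs)))
                (subT*-lookup-tabulate xs))
         (instantiate xs (ax-Pr0 g h)))

Pr-suc-eq : (g : PR n) (h : PR (suc (suc n))) (xs : Vec (Tm m) n) (y : Tm m) →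
            Der m χ (app (Pr g h) (xs ∷ʳ S y) ≐ app h ((xs ∷ʳ y) ∷ʳ app (Pr g h) (xs ∷ʳ y)))
Pr-suc-eq g h xs y = cut ⊤-intro
  (castʳ (cong₂ (λ us vs → app (Pr g h) us ≐ app h vs)
                (xs-∷ʳ (S v₀))
                (trans (subT*-∷ʳ (lookup (y ∷ xs)) _ _) (cong₂ _∷ʳ_ (xs-∷ʳ v₀) (cong (app (Pr g h)) (xs-∷ʳ v₀)))))
         (instantiate (y ∷ xs) (ax-PrS g h)))
  where
  tail-vars = tabulate (λ i → var (suc i))
  xs-∷ʳ : (a : Tm (suc _)) → subT* (lookup (y ∷ xs)) (tail-vars ∷ʳ a) ≡ xs ∷ʳ subT (lookup (y ∷ xs)) a
  xs-∷ʳ a = trans (subT*-∷ʳ (lookup (y ∷ xs)) tail-vars a)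
                  (cong (_∷ʳ subT (lookup (y ∷ xs)) a) (trans (subT*-tabulate (lookup (y ∷ xs)) _) (tabulate∘lookup xs)))

_+ᵀ_ : Tm n → Tm n → Tm n
t +ᵀ u = app add (t ∷ u ∷ [])

+ᵀ-zero : (t : Tm n) → Der n χ (t +ᵀ 𝟘 ≐ t)
+ᵀ-zero t = ≐-trans (Pr-zero-eq _ _ (t ∷ [])) (π-eq zero (t ∷ []))

+ᵀ-suc : (t u : Tm n) → Der n χ (t +ᵀ S u ≐ S (t +ᵀ u))
+ᵀ-suc t u = ≐-trans (Pr-suc-eq _ _ (t ∷ []) u) (≐-trans (Cn-eq s _ _) (S-cong (π-eq _ (t ∷ u ∷ t +ᵀ u ∷ []))))

+ᵀ-congʳ : (w : Tm n) → Der n χ (t ≐ u) → Der n χ (w +ᵀ t ≐ w +ᵀ u)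
+ᵀ-congʳ {t = t} {u = u} w t≐u =
  cut (∧-intro t≐u (≐-refl (w +ᵀ t))) (instantiate (t ∷ u ∷ w ∷ []) (eq-repl v₀ v₁ (v₃ +ᵀ v₁ ≐ v₃ +ᵀ v₀)))

≺-intro : Der n χ (t +ᵀ S u ≐ w) → Der n χ (t ≺ w)
≺-intro {t = t} {u = u} {w = w} t+Su≐w = cut t+Su≐w (instantiate (u ∷ t ∷ w ∷ []) generic)
  where
  generic : Der 3 (v₁ +ᵀ S v₀ ≐ v₂) (v₁ ≺ v₂)
  generic = cut (∃-intro (v₂ +ᵀ S v₀ ≐ v₃) v₀) (instantiate (v₁ ∷ v₂ ∷ []) ax-<⇐)

≺-𝟘 : Der n (t ≺ 𝟘) ⊥'
≺-𝟘 {t = t} = cut (instantiate (t ∷ 𝟘 ∷ []) ax-<⇒) (∃-left (S≢𝟘 (≐-trans (≐-sym (+ᵀ-suc _ v₀)) iden)))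

zero-or-suc : (t : Tm n) → Der n χ ((t ≐ 𝟘) ∨' ∃' (wkT t ≐ S v₀))
zero-or-suc t = cut ⊤-intro (instantiate (t ∷ []) generic)
  where
  generic : Der 1 ⊤' ((v₀ ≐ 𝟘) ∨' ∃' (v₁ ≐ S v₀))
  generic = IndR {ψ = ⊤'} (cut (≐-refl 𝟘) ∨-introˡ)
                          (cut (≐-refl (S v₀)) (cut (∃-intro (S v₁ ≐ S v₀) v₀) ∨-introʳ))

≺-suc : Der n (t ≺ S u) ((t ≺ u) ∨' (t ≐ u))
≺-suc {t = t} {u = u} = instantiate (t ∷ u ∷ []) generic
  where
  -- v₀ is c in x + S c ≐ S y, v₁ is x and v₂ is y; then x + c ≐ y, and c is 𝟘 or a successor.
  x+c≐y : Der 3 (v₁ +ᵀ S v₀ ≐ S v₂) (v₁ +ᵀ v₀ ≐ v₂)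
  x+c≐y = S-injective (≐-trans (≐-sym (+ᵀ-suc v₁ v₀)) iden)
  c≐𝟘 : Der 3 ((v₁ +ᵀ v₀ ≐ v₂) ∧' (v₀ ≐ 𝟘)) ((v₁ ≺ v₂) ∨' (v₁ ≐ v₂))
  c≐𝟘 = cut (≐-trans (≐-sym (≐-trans (+ᵀ-congʳ v₁ ∧-elimʳ) (+ᵀ-zero v₁))) ∧-elimˡ) ∨-introʳ
  c≐S : Der 3 ((v₁ +ᵀ v₀ ≐ v₂) ∧' ∃' (v₁ ≐ S v₀)) ((v₁ ≺ v₂) ∨' (v₁ ≐ v₂))
  c≐S = cut frob (∃-left (cut (≺-intro (≐-trans (≐-sym (+ᵀ-congʳ v₂ ∧-elimʳ)) ∧-elimˡ)) ∨-introˡ))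
  generic : Der 2 (v₀ ≺ S v₁) ((v₀ ≺ v₁) ∨' (v₀ ≐ v₁))
  generic = cut (instantiate (v₀ ∷ S v₁ ∷ []) ax-<⇒)
                (∃-left (cut (∧-intro x+c≐y (zero-or-suc v₀)) (cut distr (∨-elim c≐𝟘 c≐S))))

∅ : Env 0
∅ ()

Evaluates : Tm 0 → Set
Evaluates t = Der 0 ⊤' (t ≐ num (evalT ∅ t))

≐num-resp : {a b : ℕ} → a ≡ b → Der n χ (t ≐ num a) → Der n χ (t ≐ num b)
≐num-resp {t = t} a≡b = castʳ (cong (λ c → t ≐ num c) a≡b)

num-evaluates : (a : ℕ) → Evaluates (num a)
num-evaluates a = ≐num-resp (sym (evalT-num ∅ a)) (≐-refl (num a))

All-∷ʳ⁺ : {A : Set} {P : A → Set} {xs : Vec A k} {x : A} → All P xs → P x → All P (xs ∷ʳ x)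
All-∷ʳ⁺ [] px = px ∷ []
All-∷ʳ⁺ (py ∷ pxs) px = py ∷ All-∷ʳ⁺ pxs px

All-∷ʳ⁻ : {A : Set} {P : A → Set} (xs : Vec A k) {x : A} → All P (xs ∷ʳ x) → All P xs × P x
All-∷ʳ⁻ [] (px ∷ []) = [] , px
All-∷ʳ⁻ (y ∷ xs) (py ∷ pxs) with All-∷ʳ⁻ xs pxs
... | pys , px = py ∷ pys , px

app-∷ʳ-cong : (f : PR (suc k)) (xs : Vec (Tm n) k) → Der n χ (u ≐ u′) → Der n χ (app f (xs ∷ʳ u) ≐ app f (xs ∷ʳ u′))
app-∷ʳ-cong {u = u} {u′ = u′} f xs u≐u′ =
  castʳ (φ⟨_⟩ u′) (≐-subst φ u≐u′ (castʳ (sym (φ⟨_⟩ u)) (≐-refl (app f (xs ∷ʳ u)))))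
  where
  φ = wkT (app f (xs ∷ʳ u)) ≐ app f (subT* (λ i → var (suc i)) xs ∷ʳ v₀)
  φ⟨_⟩ : (t : Tm _) → φ ⟨ t ⟩ ≡ (app f (xs ∷ʳ u) ≐ app f (xs ∷ʳ t))
  φ⟨ t ⟩ = trans (⟨⟩≡[sub₀] φ t)
    (cong₂ _≐_ (sub₀-wkT t _)
               (cong (app f) (trans (subT*-∷ʳ (sub₀ t) _ v₀)
                                    (cong (_∷ʳ t) (trans (subT*-subT _ (sub₀ t) xs) (subT*-id (λ _ → refl) xs))))))

-- Arguments are assumed to evaluate rather than to be numerals, so that Cn needs no
-- congruence rule for the arguments of h.
mutual
  app-evaluates : (f : PR k) (ts : Vec (Tm 0) k) → All Evaluates ts → Evaluates (app f ts)
  app-evaluates z (t ∷ []) _ = instantiate (t ∷ []) ax-z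
  app-evaluates s (t ∷ []) (t↓ ∷ []) = S-cong t↓
  app-evaluates (π n k) ts ts↓ =
    ≐-trans (π-eq k ts) (≐num-resp (sym (lookup-evalT* ∅ ts k)) (lookup⁺ ts↓ k))
  app-evaluates (Cn h gs) ts ts↓ =
    ≐-trans (Cn-eq h gs ts)
            (≐num-resp (cong ⟦ h ⟧ (evalT*-appAll ∅ gs ts)) (app-evaluates h (appAll gs ts) (appAll-evaluates gs ts ts↓)))
  app-evaluates (Pr g h) ts ts↓ with initLast ts
  ... | xs , y , refl with All-∷ʳ⁻ xs ts↓
  ... | xs↓ , y↓ =
    ≐num-resp (sym (⟦Pr⟧-evalT*-∷ʳ ∅ g h xs y))
              (≐-trans (app-∷ʳ-cong (Pr g h) xs y↓) (Pr-num-evaluates g h xs xs↓ (evalT ∅ y)))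

  appAll-evaluates : (gs : Vec (PR k) l) (ts : Vec (Tm 0) k) → All Evaluates ts → All Evaluates (appAll gs ts)
  appAll-evaluates [] ts ts↓ = []
  appAll-evaluates (g ∷ gs) ts ts↓ = app-evaluates g ts ts↓ ∷ appAll-evaluates gs ts ts↓

  Pr-num-evaluates : (g : PR k) (h : PR (suc (suc k))) (xs : Vec (Tm 0) k) → All Evaluates xs → (b : ℕ) →
                     Der 0 ⊤' (app (Pr g h) (xs ∷ʳ num b) ≐ num (prec g h (evalT* ∅ xs) b))
  Pr-num-evaluates g h xs xs↓ zero = ≐-trans (Pr-zero-eq g h xs) (app-evaluates g xs xs↓)
  Pr-num-evaluates g h xs xs↓ (suc b) =
    ≐-trans (Pr-suc-eq g h xs (num b)) (≐num-resp (cong ⟦ h ⟧ args-value) (app-evaluates h args args↓))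
    where
    previous = app (Pr g h) (xs ∷ʳ num b)
    args = (xs ∷ʳ num b) ∷ʳ previous
    previous-value : evalT ∅ previous ≡ prec g h (evalT* ∅ xs) b
    previous-value = trans (⟦Pr⟧-evalT*-∷ʳ ∅ g h xs (num b)) (cong (prec g h _) (evalT-num ∅ b))
    args↓ : All Evaluates args
    args↓ = All-∷ʳ⁺ (All-∷ʳ⁺ xs↓ (num-evaluates b))
                    (≐num-resp (sym previous-value) (Pr-num-evaluates g h xs xs↓ b))
    args-value : evalT* ∅ args ≡ (evalT* ∅ xs ∷ʳ b) ∷ʳ prec g h (evalT* ∅ xs) b
    args-value = trans (evalT*-∷ʳ ∅ _ previous)
                       (cong₂ _∷ʳ_ (trans (evalT*-∷ʳ ∅ xs (num b)) (cong (evalT* ∅ xs ∷ʳ_) (evalT-num ∅ b)))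
                                   previous-value)

mutual
  closed-evaluates : (t : Tm 0) → Evaluates t
  closed-evaluates 𝟘 = ≐-refl 𝟘
  closed-evaluates (app f ts) = app-evaluates f ts (closed-evaluates* ts)

  closed-evaluates* : (ts : Vec (Tm 0) k) → All Evaluates ts
  closed-evaluates* [] = []
  closed-evaluates* (t ∷ ts) = closed-evaluates t ∷ closed-evaluates* ts

numerals : Env n → Sub n 0
numerals ρ i = num (ρ i)

numerals-evaluates : (ρ : Env n) (t : Tm n) → Der 0 ⊤' (subT (numerals ρ) t ≐ num (evalT ρ t))
numerals-evaluates ρ t =
  ≐num-resp (evalT-subT-≗ (λ i → evalT-num ∅ (ρ i)) t) (closed-evaluates (subT (numerals ρ) t))

numerals-,, : (φ : Fm (suc n)) (ρ : Env n) (a : ℕ) → (φ [ liftS (numerals ρ) ]) ⟨ num a ⟩ ≡ φ [ numerals (ρ ,, a) ]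
numerals-,, φ ρ a = []-⟨⟩-≗ (num a) (λ { zero → refl ; (suc i) → sub₀-wkT (num a) (num (ρ i)) }) φ

num-≺ : {a b : ℕ} → a < b → Der 0 ⊤' (num a ≺ num b)
num-≺ {a} {b} a<b = ≺-intro (≐num-resp value (closed-evaluates (num a +ᵀ S (num (b ∸ suc a)))))
  where
  value : evalT ∅ (num a +ᵀ S (num (b ∸ suc a))) ≡ b
  value = trans (cong₂ (λ x y → ⟦ add ⟧ (x ∷ y ∷ [])) (evalT-num ∅ a) (evalT-num ∅ (suc (b ∸ suc a))))
                (<⇒⟦add⟧-suc a<b)

≐-num-elim : (φ : Fm 1) (b : ℕ) → Der 0 ⊤' (φ ⟨ num b ⟩) → Der 1 (v₀ ≐ num b) φ
≐-num-elim φ b ⊢φb = castʳ (trans (φ′⟨ v₀ ⟩) ([]-id (λ { zero → refl }) φ))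
  (≐-subst φ′ (≐-sym iden) (castʳ (sym (φ′⟨ num b ⟩)) (cut ⊤-intro (castʳ weakened (subst (λ ()) ⊢φb)))))
  where
  φ′ : Fm 2
  φ′ = φ [ lookup (v₀ ∷ []) ]
  φ′⟨_⟩ : (t : Tm 1) → φ′ ⟨ t ⟩ ≡ φ [ lookup (t ∷ []) ]
  φ′⟨ t ⟩ = []-⟨⟩-≗ t (λ { zero → refl ; (suc ()) }) φ
  weakened : (φ ⟨ num b ⟩) [ (λ ()) ] ≡ φ [ lookup (num b ∷ []) ]
  weakened = trans (cong (_[ (λ ()) ]) (⟨⟩≡[sub₀] φ (num b))) ([]-[]-≗ (λ { zero → subT-num _ b }) φ)

≺-num-elim : (b : ℕ) (φ : Fm 1) → ((a : ℕ) → a < b → Der 0 ⊤' (φ ⟨ num a ⟩)) → Der 1 (v₀ ≺ num b) φ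
≺-num-elim zero φ ⊢φ = cut ≺-𝟘 ⊥-elim
≺-num-elim (suc b) φ ⊢φ =
  cut ≺-suc (∨-elim (≺-num-elim b φ (λ a a<b → ⊢φ a (m<n⇒m<1+n a<b))) (≐-num-elim φ b (⊢φ b (n<1+n b))))

completeness : (φ : Fm n) (ρ : Env n) → Sat ρ φ → Der 0 ⊤' (φ [ numerals ρ ])
completeness (t ≐ u) ρ t≡u = ≐-trans (≐num-resp t≡u (numerals-evaluates ρ t)) (≐-sym (numerals-evaluates ρ u))
completeness (t ≺ u) ρ t<u =
  ≺-respˡ (numerals-evaluates ρ t) (≺-respʳ (≐-sym (numerals-evaluates ρ u)) (num-≺ t<u))
completeness ⊤' ρ _ = ⊤-intro
completeness (φ ∧' ψ) ρ (⊨φ , ⊨ψ) = ∧-intro (completeness φ ρ ⊨φ) (completeness ψ ρ ⊨ψ)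
completeness (φ ∨' ψ) ρ (inj₁ ⊨φ) = cut (completeness φ ρ ⊨φ) ∨-introˡ
completeness (φ ∨' ψ) ρ (inj₂ ⊨ψ) = cut (completeness ψ ρ ⊨ψ) ∨-introʳ
completeness (∃' φ) ρ (a , ⊨φa) =
  cut (castʳ (sym (numerals-,, φ ρ a)) (completeness φ (ρ ,, a) ⊨φa)) (∃-intro _ (num a))
completeness (∀<' t φ) ρ ⊨∀φ = ∀<-right {ψ = ⊤'} (cut (≺-respʳ bound ∧-elimʳ) (≺-num-elim _ _ instances))
  where
  θt = subT (numerals ρ) t
  bound : Der 1 (⊤' ∧' (v₀ ≺ wkT θt)) (wkT θt ≐ num (evalT ρ t))
  bound = cut ⊤-intro
    (castʳ (cong₂ _≐_ (trans (subT-cong (λ ()) θt) (sym (renT≡subT suc θt))) (subT-num _ (evalT ρ t)))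
           (subst (λ ()) (numerals-evaluates ρ t)))
  instances : (a : ℕ) → a < evalT ρ t → Der 0 ⊤' ((φ [ liftS (numerals ρ) ]) ⟨ num a ⟩)
  instances a a<t = castʳ (sym (numerals-,, φ ρ a)) (completeness φ (ρ ,, a) (⊨∀φ a a<t))

theorem7p3 : (φ : Sentence) → (Provable φ → TrueInℕ φ) × (TrueInℕ φ → Provable φ)
theorem7p3 φ = (λ ⊢φ → soundness ⊢φ _ tt) , (λ ⊨φ → castʳ ([]-id (λ ()) φ) (completeness φ _ ⊨φ))
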